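{- Let $\mathbf{A}$ be a finite lattice algebra, $\tau$ a denumerable set of propositional variables and $\mathbb{F}$ a class of frames. Then for every set $\Gamma\cup\{\varphi\}\subseteq\mathrm{Fm}_{\mathbf{A}}^{\Diamond\Box}(\tau)$: (1) $\Gamma\vDash_{\mathrm{Log}(\mathbb{F},\mathbf{A},\tau)}\varphi$ if and only if $\{q^{1_{\mathbf{A}}}_\theta:\theta\in\Gamma\}\cup T^*(\tau)\cup\{E(\psi):\psi\in\mathrm{Fm}_{\mathbf{A}}^{\Diamond\Box}(\tau)\}\vDash_{\mathrm{Log}(\mathbb{F},\mathbf{2},\tau^*)}q^{1_{\mathbf{A}}}_\varphi$; (2) if $\Gamma\cup\{\varphi\}$ is finite, then in (1) the theory $T^*(\tau)\cup\{E(\psi):\psi\in\mathrm{Fm}_{\mathbf{A}}^{\Diamond\Box}(\tau)\}$ may be replaced by the finite set consisting of those of its formulas relevant to formulas $\psi$ that are subformulas of some formula of $\Gamma\cup\{\varphi\}$ (i.e. the formulas of $T^*$ for variables occurring in $\Gamma\cup\{\varphi\}$ and the formulas $E(\psi)$ for such subformulas $\psi$); (3) $\vDash_{\mathrm{Log}(\mathbb{F},\mathbf{A},\tau)}\varphi$ if and only if $\vDash_{\mathrm{Log}(\mathbb{F},\mathbf{2},\tau^*)}\Big(\bigwedge_{m\le\mathrm{rank}(\varphi)}\Box^m\big(\bigwedge(T^*_\varphi\cup\{E(\psi):\psi\text{ a subformula of }\varphi\})\big)\Big)\Rightarrow q^{1_{\mathbf{A}}}_\varphi$, where $T^*_\varphi$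 is the set of formulas of $T^*(\tau)$ involving only variables occurring in $\varphi$.
   Context: A finite lattice algebra is a finite (hence bounded) lattice $\mathbf{A}$ possibly expanded with further finitary operations; bottom and top are $0_{\mathbf{A}},1_{\mathbf{A}}$. $\mathrm{Fm}_{\mathbf{A}}^{\Diamond\Box}(\tau)$ is the set of formulas over $\tau=\{p_1,p_2,\ldots\}$ built with $\wedge,\vee$, an $n$-ary connective for each additional $n$-ary operation of $\mathbf{A}$, and modalities $\Diamond,\Box$. $\mathrm{Fm}_{\mathbf{2}}^{\Diamond\Box}(\sigma)$ is the classical modal language over variables $\sigma$; $\Rightarrow,\Leftrightarrow$ denote material implication and equivalence. A frame is $\langle W,R\rangle$ with $W\ne\emptyset$, $R\subseteq W^2$. An $\mathbf{A}$-valued model on it is given by $V:\tau\times W\to A$, connectives evaluated pointwise, $\|\Diamond\psi\|_w=\sup\{\|\psi\|_v:Rwv\}$, $\|\Box\psi\|_w=\inf\{\|\psi\|_v:Rwv\}$; a formula is globally true if it has value $1_{\mathbf{A}}$ at every world. For a finite lattice algebra $\mathbf{C}$ and variables $\sigma$, $\Gamma\vDash_{\mathrm{Log}(\mathbb{F},\mathbf{C},\sigma)}\varphi$ means: for every frame in $\mathbb{F}$ and every $\mathbf{C}$-valued model on it, if all of $\Gamma$ is globally true then so is $\varphi$; $\vDash\varphi$ is the case $\Gamma=\emptyset$. $\mathrm{rank}(\varphi)$ is the modal depth (maximal nesting of modalities) of $\varphi$ and $\Box^m$ is $m$ iterations of $\Box$. Let $\tau^*=\{q^a_\psi: a\in A,\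 \psi\in\mathrm{Fm}_{\mathbf{A}}^{\Diamond\Box}(\tau)\}$ (new classical variables). $T^*(\tau)$ consists of $\bigvee_{a\in A}q^a_{p_i}$ and $\neg(q^a_{p_i}\wedge q^b_{p_i})$ for all $p_i\in\tau$, $a,b\in A$, $a\ne b$. For each $\psi$, $E(\psi)$ denotes the set (conjunction) of the following formulas, one for each $a\in A$: if $\psi=\circ(\psi_1,\ldots,\psi_n)$ for a connective $\circ$ (including $\wedge,\vee$): $q^a_\psi\Leftrightarrow\bigvee_{b_1,\ldots,b_n\in A,\ \circ^{\mathbf{A}}(b_1,\ldots,b_n)=a}(q^{b_1}_{\psi_1}\wedge\cdots\wedge q^{b_n}_{\psi_n})$; if $\psi=\Diamond\chi$: $q^a_\psi\Leftrightarrow\Big(\bigvee_{k\le|A|,\ b_1\vee^{\mathbf{A}}\cdots\vee^{\mathbf{A}}b_k=a}\bigwedge_{i=1}^k\Diamond q^{b_i}_\chi\Big)\wedge\Box\Big(\bigvee_{b\le a}q^b_\chi\Big)$; if $\psi=\Box\chi$: $q^a_\psi\Leftrightarrow\Big(\bigvee_{k\le|A|,\ b_1\wedge^{\mathbf{A}}\cdots\wedge^{\mathbf{A}}b_k=a}\bigwedge_{i=1}^k\Diamond q^{b_i}_\chi\Big)\wedge\Box\Big(\bigvee_{a\le b}q^b_\chi\Big)$; if $\psi$ is a variable, $E(\psi)$ is empty. In these formulas $k$ ranges over $0\le k\le|A|$ with the empty join in $\mathbf{A}$ being $0_{\mathbf{A}}$, the empty meet being $1_{\mathbf{A}}$, empty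 conjunction $\top$ and empty disjunction $\bot$. -}

module Defs where

open import Level using (0ℓ)
open import Data.Nat using (ℕ; zero; suc; _⊔_)
open import Data.Fin using (Fin)
open import Data.Bool using (Bool; true; false; not; if_then_else_)
  renaming (_∧_ to _∧ᵇ_; _∨_ to _∨ᵇ_)
import Data.Bool.Properties as BoolP
open import Data.Vec using (Vec; []; _∷_)
import Data.Vec as Vec
open import Data.List using (List; []; _∷_; _++_; map; concatMap; length; upTo; filter)
open import Data.List.Membership.Propositional using (_∈_)
open import Data.List.Relation.Unary.Unique.Propositional using (Unique)
open import Data.Product using (Σ; ∃; _×_; _,_; proj₁; proj₂)
open import Data.Sum using (_⊎_)
open import Relation.Binary.PropositionalEquality using (_≡_; _≢_)
open import Relation.Binary.Definitions using (DecidableEquality)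
open import Relation.Nullary using (¬_; Dec; yes; no)
open import Relation.Nullary.Decidable using (¬?)
open import Relation.Unary using (Pred)
open import Data.Empty using (⊥)
open import Algebra.Lattice.Structures using (IsLattice)

record LatticeAlgebra : Set₁ where
  infixr 7 _∧_
  infixr 6 _∨_
  field
    Carrier   : Set
    _∨_       : Carrier → Carrier → Carrier
    _∧_       : Carrier → Carrier → Carrier
    isLattice : IsLattice _≡_ _∨_ _∧_
    Op        : Set
    arity     : Op → ℕ
    ⟦_⟧       : (o : Op) → Vec Carrier (arity o) → Carrier
    elems     : List Carrier
    complete  : ∀ x → x ∈ elems
    unique    : Unique elems
    _≟_       : DecidableEquality Carrier

  _≤_ : Carrier → Carrier → Set
  a ≤ b = a ∧ b ≡ a

  _≤?_ : ∀ a b → Dec (a ≤ b)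
  a ≤? b = (a ∧ b) ≟ a

  field
    0A     : Carrier
    1A     : Carrier
    0-least : ∀ x → 0A ≤ x
    1-greatest : ∀ x → x ≤ 1A

  size : ℕ
  size = length elems

  IsUpperBound : Pred Carrier 0ℓ → Carrier → Set
  IsUpperBound S a = ∀ b → S b → b ≤ a

  IsLowerBound : Pred Carrier 0ℓ → Carrier → Set
  IsLowerBound S a = ∀ b → S b → a ≤ b

  IsSup : Pred Carrier 0ℓ → Carrier → Set
  IsSup S a = IsUpperBound S a × (∀ u → IsUpperBound S u → a ≤ u)

  IsInf : Pred Carrier 0ℓ → Carrier → Set
  IsInf S a = IsLowerBound S a × (∀ l → IsLowerBound S l → l ≤ a)

  ⨆ : ∀ {k} → Vec Carrier k → Carrier
  ⨆ []       = 0A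
  ⨆ (b ∷ bs) = b ∨ ⨆ bs

  ⨅ : ∀ {k} → Vec Carrier k → Carrier
  ⨅ []       = 1A
  ⨅ (b ∷ bs) = b ∧ ⨅ bs

  tuples : (k : ℕ) → List (Vec Carrier k)
  tuples zero    = [] ∷ []
  tuples (suc k) = concatMap (λ b → map (b ∷_) (tuples k)) elems

open LatticeAlgebra public using (Op; arity)

CarrierOf : LatticeAlgebra → Set
CarrierOf = LatticeAlgebra.Carrier

data Fm (A : LatticeAlgebra) (X : Set) : Set where
  var    : X → Fm A X
  _∧ᶠ_   : Fm A X → Fm A X → Fm A X
  _∨ᶠ_   : Fm A X → Fm A X → Fm A X
  op     : (o : Op A) → Vec (Fm A X) (arity A o) → Fm A X
  ◇      : Fm A X → Fm A X
  □      : Fm A X → Fm A X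

infixr 7 _∧ᶠ_
infixr 6 _∨ᶠ_

module _ {A : LatticeAlgebra} {X : Set} where

  mutual
    subs : Fm A X → List (Fm A X)
    subs (var x)    = var x ∷ []
    subs (φ ∧ᶠ ψ)   = (φ ∧ᶠ ψ) ∷ subs φ ++ subs ψ
    subs (φ ∨ᶠ ψ)   = (φ ∨ᶠ ψ) ∷ subs φ ++ subs ψ
    subs (op o φs)  = op o φs ∷ subsV φs
    subs (◇ φ)      = ◇ φ ∷ subs φ
    subs (□ φ)      = □ φ ∷ subs φ

    subsV : ∀ {n} → Vec (Fm A X) n → List (Fm A X)
    subsV []       = []
    subsV (φ ∷ φs) = subs φ ++ subsV φs

  mutual
    vars : Fm A X → List X
    vars (var x)    = x ∷ []
    vars (φ ∧ᶠ ψ)   = vars φ ++ vars ψ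
    vars (φ ∨ᶠ ψ)   = vars φ ++ vars ψ
    vars (op o φs)  = varsV φs
    vars (◇ φ)      = vars φ
    vars (□ φ)      = vars φ

    varsV : ∀ {n} → Vec (Fm A X) n → List X
    varsV []       = []
    varsV (φ ∷ φs) = vars φ ++ varsV φs

  mutual
    rank : Fm A X → ℕ
    rank (var x)    = 0
    rank (φ ∧ᶠ ψ)   = rank φ ⊔ rank ψ
    rank (φ ∨ᶠ ψ)   = rank φ ⊔ rank ψ
    rank (op o φs)  = rankV φs
    rank (◇ φ)      = suc (rank φ)
    rank (□ φ)      = suc (rank φ)

    rankV : ∀ {n} → Vec (Fm A X) n → ℕ
    rankV []       = 0
    rankV (φ ∷ φs) = rank φ ⊔ rankV φs

record Frame : Set₁ where
  field
    W        : Set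
    R        : W → W → Set
    nonempty : W

open Frame public

record IsEvaluation (A : LatticeAlgebra) {X : Set} (F : Frame)
         (V : X → W F → CarrierOf A) (ev : Fm A X → W F → CarrierOf A) : Set where
  open LatticeAlgebra A
  field
    ev-var : ∀ x w → ev (var x) w ≡ V x w
    ev-∧   : ∀ φ ψ w → ev (φ ∧ᶠ ψ) w ≡ ev φ w ∧ ev ψ w
    ev-∨   : ∀ φ ψ w → ev (φ ∨ᶠ ψ) w ≡ ev φ w ∨ ev ψ w
    ev-op  : ∀ o φs w → ev (op o φs) w ≡ ⟦ o ⟧ (Vec.map (λ φ → ev φ w) φs)
    ev-◇   : ∀ φ w → IsSup (λ a → Σ (W F) λ v → R F w v × ev φ v ≡ a) (ev (◇ φ) w)
    ev-□   : ∀ φ w → IsInf (λ a → Σ (W F) λ v → R F w v × ev φ v ≡ a) (ev (□ φ) w)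

Consequence : (𝔽 : Pred Frame 0ℓ) (A : LatticeAlgebra) (X : Set) →
              Pred (Fm A X) 0ℓ → Fm A X → Set₁
Consequence 𝔽 A X Γ φ =
  ∀ (F : Frame) → 𝔽 F →
  ∀ (V : X → W F → CarrierOf A) (ev : Fm A X → W F → CarrierOf A) →
  IsEvaluation A F V ev →
  (∀ θ → Γ θ → ∀ w → ev θ w ≡ LatticeAlgebra.1A A) →
  ∀ w → ev φ w ≡ LatticeAlgebra.1A A

Valid : (𝔽 : Pred Frame 0ℓ) (A : LatticeAlgebra) (X : Set) → Fm A X → Set₁
Valid 𝔽 A X φ = Consequence 𝔽 A X (λ _ → ⊥) φ

data BoolOp : Set where
  ⊤ᵒ ⊥ᵒ ¬ᵒ ⇒ᵒ ⇔ᵒ : BoolOp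

boolArity : BoolOp → ℕ
boolArity ⊤ᵒ = 0
boolArity ⊥ᵒ = 0
boolArity ¬ᵒ = 1
boolArity ⇒ᵒ = 2
boolArity ⇔ᵒ = 2

boolSem : (o : BoolOp) → Vec Bool (boolArity o) → Bool
boolSem ⊤ᵒ []          = true
boolSem ⊥ᵒ []          = false
boolSem ¬ᵒ (x ∷ [])    = not x
boolSem ⇒ᵒ (x ∷ y ∷ []) = not x ∨ᵇ y
boolSem ⇔ᵒ (x ∷ y ∷ []) = if x then y else not y

private
  boolUnique : Unique (false ∷ true ∷ [])
  boolUnique = ((λ ()) Data.List.Relation.Unary.All.∷ Data.List.Relation.Unary.All.[])
                 Data.List.Relation.Unary.AllPairs.∷ (Data.List.Relation.Unary.All.[] Data.List.Relation.Unary.AllPairs.∷ Data.List.Relation.Unary.AllPairs.[])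
    where import Data.List.Relation.Unary.All
          import Data.List.Relation.Unary.AllPairs

  boolComplete : ∀ x → x ∈ (false ∷ true ∷ [])
  boolComplete false = Data.List.Relation.Unary.Any.here _≡_.refl
    where import Data.List.Relation.Unary.Any
  boolComplete true  = Data.List.Relation.Unary.Any.there (Data.List.Relation.Unary.Any.here _≡_.refl)
    where import Data.List.Relation.Unary.Any

𝟚 : LatticeAlgebra
𝟚 = record
  { Carrier    = Bool
  ; _∨_        = _∨ᵇ_
  ; _∧_        = _∧ᵇ_
  ; isLattice  = BoolP.∨-∧-isLattice
  ; Op         = BoolOp
  ; arity      = boolArity
  ; ⟦_⟧        = boolSem
  ; elems      = false ∷ true ∷ []
  ; complete   = boolComplete
  ; unique     = boolUnique
  ; _≟_        = BoolP._≟_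
  ; 0A         = false
  ; 1A         = true
  ; 0-least    = λ _ → _≡_.refl
  ; 1-greatest = λ { false → _≡_.refl ; true → _≡_.refl }
  }

module _ {σ : Set} where
  ⊤ᶜ ⊥ᶜ : Fm 𝟚 σ
  ⊤ᶜ = op ⊤ᵒ []
  ⊥ᶜ = op ⊥ᵒ []

  ¬ᶜ : Fm 𝟚 σ → Fm 𝟚 σ
  ¬ᶜ φ = op ¬ᵒ (φ ∷ [])

  _⇒ᶜ_ _⇔ᶜ_ : Fm 𝟚 σ → Fm 𝟚 σ → Fm 𝟚 σ
  φ ⇒ᶜ ψ = op ⇒ᵒ (φ ∷ ψ ∷ [])
  φ ⇔ᶜ ψ = op ⇔ᵒ (φ ∷ ψ ∷ [])

  ⋀ : List (Fm 𝟚 σ) → Fm 𝟚 σ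
  ⋀ []           = ⊤ᶜ
  ⋀ (φ ∷ [])     = φ
  ⋀ (φ ∷ ψ ∷ φs) = φ ∧ᶠ ⋀ (ψ ∷ φs)

  ⋁ : List (Fm 𝟚 σ) → Fm 𝟚 σ
  ⋁ []           = ⊥ᶜ
  ⋁ (φ ∷ [])     = φ
  ⋁ (φ ∷ ψ ∷ φs) = φ ∨ᶠ ⋁ (ψ ∷ φs)

  □^ : ℕ → Fm 𝟚 σ → Fm 𝟚 σ
  □^ zero    φ = φ
  □^ (suc m) φ = □ (□^ m φ)

module Translation (A : LatticeAlgebra) where
  open LatticeAlgebra A

  τ : Set
  τ = ℕ

  τ* : Set
  τ* = Carrier × Fm A τ

  q : Carrier → Fm A τ → Fm 𝟚 τ*
  q a ψ = var (a , ψ)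

  qs : ∀ {n} → Vec Carrier n → Vec (Fm A τ) n → List (Fm 𝟚 τ*)
  qs []       []       = []
  qs (b ∷ bs) (ψ ∷ ψs) = q b ψ ∷ qs bs ψs

  TFor : τ → List (Fm 𝟚 τ*)
  TFor p = ⋁ (map (λ a → q a (var p)) elems)
         ∷ concatMap (λ a → map (λ b → ¬ᶜ (q a (var p) ∧ᶠ q b (var p)))
                                (filter (λ b → ¬? (a ≟ b)) elems)) elems

  TStar : Pred (Fm 𝟚 τ*) 0ℓ
  TStar χ = Σ τ λ p → χ ∈ TFor p

  pairs : List (Carrier × Carrier)
  pairs = concatMap (λ b₁ → map (b₁ ,_) elems) elems

  smallTuples : List (Σ ℕ λ k → Vec Carrier k)
  smallTuples = concatMap (λ k → map (k ,_) (tuples k)) (upTo (suc size))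

  ◇qs : ∀ {k} → Vec Carrier k → Fm A τ → List (Fm 𝟚 τ*)
  ◇qs []       χ = []
  ◇qs (b ∷ bs) χ = ◇ (q b χ) ∷ ◇qs bs χ

  Eform : Fm A τ → Carrier → Fm 𝟚 τ*
  Eform (var p) a = ⊤ᶜ   -- not used: E(var p) is empty
  Eform (ψ₁ ∧ᶠ ψ₂) a = q a (ψ₁ ∧ᶠ ψ₂) ⇔ᶜ
    ⋁ (map (λ bb → q (proj₁ bb) ψ₁ ∧ᶠ q (proj₂ bb) ψ₂)
           (filter (λ bb → (proj₁ bb ∧ proj₂ bb) ≟ a) pairs))
  Eform (ψ₁ ∨ᶠ ψ₂) a = q a (ψ₁ ∨ᶠ ψ₂) ⇔ᶜ
    ⋁ (map (λ bb → q (proj₁ bb) ψ₁ ∧ᶠ q (proj₂ bb) ψ₂)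
           (filter (λ bb → (proj₁ bb ∨ proj₂ bb) ≟ a) pairs))
  Eform (op o ψs) a = q a (op o ψs) ⇔ᶜ
    ⋁ (map (λ bs → ⋀ (qs bs ψs))
           (filter (λ bs → ⟦ o ⟧ bs ≟ a) (tuples (arity A o))))
  Eform (◇ χ) a = q a (◇ χ) ⇔ᶜ
    (⋁ (map (λ { (k , bs) → ⋀ (◇qs bs χ) })
            (filter (λ { (k , bs) → ⨆ bs ≟ a }) smallTuples))
     ∧ᶠ □ (⋁ (map (λ b → q b χ) (filter (λ b → b ≤? a) elems))))
  Eform (□ χ) a = q a (□ χ) ⇔ᶜ
    (⋁ (map (λ { (k , bs) → ⋀ (◇qs bs χ) })
            (filter (λ { (k , bs) → ⨅ bs ≟ a }) smallTuples))
     ∧ᶠ □ (⋁ (map (λ b → q b χ) (filter (λ b → a ≤? b) elems))))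

  E : Fm A τ → List (Fm 𝟚 τ*)
  E (var p) = []
  E ψ@(_ ∧ᶠ _) = map (Eform ψ) elems
  E ψ@(_ ∨ᶠ _) = map (Eform ψ) elems
  E ψ@(op _ _) = map (Eform ψ) elems
  E ψ@(◇ _)    = map (Eform ψ) elems
  E ψ@(□ _)    = map (Eform ψ) elems

  Theory₁ : Pred (Fm A τ) 0ℓ → Pred (Fm 𝟚 τ*) 0ℓ
  Theory₁ Γ χ = (Σ (Fm A τ) λ θ → Γ θ × χ ≡ q 1A θ)
              ⊎ TStar χ
              ⊎ (Σ (Fm A τ) λ ψ → χ ∈ E ψ)

  Theory₂ : List (Fm A τ) → Fm A τ → Pred (Fm 𝟚 τ*) 0ℓ
  Theory₂ Γ φ χ = (Σ (Fm A τ) λ θ → θ ∈ Γ × χ ≡ q 1A θ)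
                ⊎ (Σ τ λ p → Σ (Fm A τ) λ θ → θ ∈ (φ ∷ Γ) × p ∈ vars θ × χ ∈ TFor p)
                ⊎ (Σ (Fm A τ) λ ψ → Σ (Fm A τ) λ θ → θ ∈ (φ ∷ Γ) × ψ ∈ subs θ × χ ∈ E ψ)

  Translate₃ : Fm A τ → Fm 𝟚 τ*
  Translate₃ φ =
    ⋀ (map (λ m → □^ m (⋀ (concatMap TFor (vars φ) ++ concatMap E (subs φ))))
           (upTo (suc (rank φ))))
    ⇒ᶜ q 1A φ

  ListSet : List (Fm A τ) → Pred (Fm A τ) 0ℓ
  ListSet Γ θ = θ ∈ Γ

{-# OPTIONS --safe #-}
-- An A-valued model yields a classical model of the translation by making q^a_ψ true at w
-- exactly when ψ has value a at w; there T* and every E(ψ) hold, and q^1_θ holds iff θ does.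
-- Conversely, in a classical model T*(p) says that exactly one q^a_p holds at each world, which
-- defines an A-valuation, and the E(ψ) force, by induction on ψ, that q^a_ψ holds exactly when
-- ψ has value a. The clauses of E(◇χ) and E(□χ) capture the modal values because in a finite
-- lattice the supremum (infimum) of the set of successor values is the join (meet) of at most
-- |A| of its members and bounds all of them; excluded middle lets us form that set. The
-- induction for ψ at w uses E only for subformulas of ψ and T* only for its variables, and only
-- at worlds at most rank ψ steps from w: this gives (2), and (3), where □^m reaches those worlds.

module Submission where

open import Defs
open import Level using (0ℓ)
open import Axiom.ExcludedMiddle using (ExcludedMiddle)
open import Data.Nat using (ℕ; zero; suc; z≤n; s≤s; _⊔_) renaming (_≤_ to _≤ℕ_)
open import Data.Nat.Properties using (m≤m⊔n; m≤n⊔m; ≤-pred) renaming (≤-trans to ≤ℕ-trans)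
open import Data.Bool using (Bool; true; false; not; T; if_then_else_)
  renaming (_∧_ to _∧ᵇ_; _∨_ to _∨ᵇ_)
open import Data.Bool.Properties using (T-≡; T-∧; T-∨; ∧-zeroʳ)
open import Data.Unit using (tt)
open import Data.Empty using (⊥; ⊥-elim)
open import Data.Product using (Σ; ∃; ∃₂; ∃!; _×_; _,_; proj₁; proj₂; uncurry)
open import Data.Product.Function.NonDependent.Propositional using (_×-⇔_)
open import Data.Sum using (_⊎_; inj₁; inj₂; [_,_]′)
open import Data.List using (List; []; _∷_; _++_; map; concatMap; length; upTo; filter)
open import Data.List.Properties using (length-filter)
open import Data.List.Membership.Propositional using (_∈_; find; lose)
open import Data.List.Membership.Propositional.Properties
  using (∈-filter⁺; ∈-filter⁻; ∈-map⁺; ∈-map⁻; ∈-concatMap⁺; ∈-concatMap⁻; ∈-++⁺ˡ; ∈-++⁺ʳ; ∈-++⁻;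
         ∈-upTo⁺; ∈-upTo⁻)
open import Data.List.Relation.Binary.Subset.Propositional using (_⊆_)
open import Data.List.Relation.Unary.Any as Any using (Any; here; there; any?)
open import Data.List.Relation.Unary.Any.Properties using (lookup-result)
import Data.List.Relation.Unary.Any.Properties as AnyP
import Data.List.Relation.Unary.All.Properties as ListAll
open import Data.Vec using (Vec; []; _∷_; fromList)
import Data.Vec as Vec
open import Data.Vec.Properties using (∷-injective)
open import Data.Vec.Relation.Unary.All as All using (All; []; _∷_)
open import Data.Vec.Relation.Unary.All.Properties using (fromList⁺)
open import Function using (_∘_; id)
open import Function.Bundles using (_⇔_; mk⇔; Equivalence)
open import Function.Properties.Equivalence using ()
  renaming (refl to ⇔-refl; trans to ⇔-trans; sym to ⇔-sym)
open import Function.Related.Propositional using (module EquationalReasoning)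
open import Relation.Binary.PropositionalEquality
open import Relation.Nullary using (¬_; Dec; yes; no)
open import Relation.Nullary.Decidable using (isYes; toWitness; fromWitness; T?; ¬?; decidable-stable)
open import Relation.Unary using (Pred; Decidable)
open import Algebra.Lattice.Bundles using (Lattice)
import Algebra.Lattice.Properties.Lattice as LatticeProperties
import Relation.Binary.Lattice as OrderLattice

open Equivalence using (to; from)

module _ (F : Frame) where

  Reachable : ℕ → W F → W F → Set
  Reachable zero    v u = v ≡ u
  Reachable (suc m) v u = ∃ λ x → R F v x × Reachable m x u

  WithinSteps : ℕ → Pred (W F) 0ℓ → W F → Set
  WithinSteps r P v = ∀ {m u} → m ≤ℕ r → Reachable m v u → P u

module _ {F : Frame} {P : Pred (W F) 0ℓ} {r : ℕ} where

  WithinSteps-here : ∀ {v} → WithinSteps F r P v → P v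
  WithinSteps-here h = h z≤n refl

  WithinSteps-≤ : ∀ {r′ v} → r′ ≤ℕ r → WithinSteps F r P v → WithinSteps F r′ P v
  WithinSteps-≤ r′≤r h m≤r′ = h (≤ℕ-trans m≤r′ r′≤r)

  WithinSteps-map : ∀ {Q : Pred (W F) 0ℓ} {v} → (∀ {u} → P u → Q u) →
                    WithinSteps F r P v → WithinSteps F r Q v
  WithinSteps-map P⇒Q h m≤r path = P⇒Q (h m≤r path)

  WithinSteps-step : ∀ {v u} → R F v u → WithinSteps F (suc r) P v → WithinSteps F r P u
  WithinSteps-step vRu h m≤r path = h (s≤s m≤r) (_ , vRu , path)

module LatticeOrder (A : LatticeAlgebra) where
  open LatticeAlgebra A

  private
    algebraicLattice : Lattice 0ℓ 0ℓ
    algebraicLattice = record { isLattice = isLattice }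

    module O = OrderLattice.Lattice (LatticeProperties.∨-∧-orderTheoreticLattice algebraicLattice)

  -- The library orders a lattice by x ≡ x ∧ y, the symmetric form of _≤_.
  ≤-trans : ∀ {a b c} → a ≤ b → b ≤ c → a ≤ c
  ≤-trans p q = sym (O.trans (sym p) (sym q))

  ≤-antisym : ∀ {a b} → a ≤ b → b ≤ a → a ≡ b
  ≤-antisym p q = O.antisym (sym p) (sym q)

  ⨆-least : ∀ {k} {bs : Vec Carrier k} {u} → All (_≤ u) bs → ⨆ bs ≤ u
  ⨆-least {u = u} []       = 0-least u
  ⨆-least         (p ∷ ps) = sym (O.∨-least (sym p) (sym (⨆-least ps)))

  ⨅-greatest : ∀ {k} {bs : Vec Carrier k} {l} → All (l ≤_) bs → l ≤ ⨅ bs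
  ⨅-greatest {l = l} []       = 1-greatest l
  ⨅-greatest         (p ∷ ps) = sym (O.∧-greatest (sym p) (sym (⨅-greatest ps)))

  ∈⇒≤⨆ : ∀ {xs : List Carrier} {x} → x ∈ xs → x ≤ ⨆ (fromList xs)
  ∈⇒≤⨆ {y ∷ _} (here refl) = sym (O.x≤x∨y y _)
  ∈⇒≤⨆ {y ∷ _} (there x∈) = ≤-trans (∈⇒≤⨆ x∈) (sym (O.y≤x∨y y _))

  ∈⇒⨅≤ : ∀ {xs : List Carrier} {x} → x ∈ xs → ⨅ (fromList xs) ≤ x
  ∈⇒⨅≤ {y ∷ _} (here refl) = sym (O.x∧y≤x y _)
  ∈⇒⨅≤ {y ∷ _} (there x∈) = ≤-trans (sym (O.x∧y≤y y _)) (∈⇒⨅≤ x∈)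

  module _ {S : Pred Carrier 0ℓ} where

    IsSup-unique : ∀ {a b} → IsSup S a → IsSup S b → a ≡ b
    IsSup-unique (ub₁ , least₁) (ub₂ , least₂) = ≤-antisym (least₁ _ ub₂) (least₂ _ ub₁)

    IsInf-unique : ∀ {a b} → IsInf S a → IsInf S b → a ≡ b
    IsInf-unique (lb₁ , greatest₁) (lb₂ , greatest₂) =
      ≤-antisym (greatest₂ _ lb₁) (greatest₁ _ lb₂)

    IsSup-≡ : ∀ {c a} → IsSup S c → c ≡ a ⇔ IsSup S a
    IsSup-≡ c-sup = mk⇔ (λ { refl → c-sup }) (IsSup-unique c-sup)

    IsInf-≡ : ∀ {c a} → IsInf S c → c ≡ a ⇔ IsInf S a
    IsInf-≡ c-inf = mk⇔ (λ { refl → c-inf }) (IsInf-unique c-inf)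

    ⨆-isSup : ∀ {k} {bs : Vec Carrier k} → All S bs → IsUpperBound S (⨆ bs) → IsSup S (⨆ bs)
    ⨆-isSup bs⊆S ub = ub , λ u u-ub → ⨆-least (All.map (u-ub _) bs⊆S)

    ⨅-isInf : ∀ {k} {bs : Vec Carrier k} → All S bs → IsLowerBound S (⨅ bs) → IsInf S (⨅ bs)
    ⨅-isInf bs⊆S lb = lb , λ l l-lb → ⨅-greatest (All.map (l-lb _) bs⊆S)

  SmallCombination : Pred Carrier 0ℓ → (∀ {k} → Vec Carrier k → Carrier) → Carrier → Set
  SmallCombination S ⨀ a = ∃₂ λ k (bs : Vec Carrier k) → k ≤ℕ size × ⨀ bs ≡ a × All S bs

  module _ (em : ExcludedMiddle 0ℓ) (S : Pred Carrier 0ℓ) where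

    private
      S? : Decidable S
      S? _ = em

      members : List Carrier
      members = filter S? elems

      members⊆S : All S (fromList members)
      members⊆S = fromList⁺ (ListAll.all-filter S? elems)

      S⊆members : ∀ {b} → S b → b ∈ members
      S⊆members Sb = ∈-filter⁺ S? (complete _) Sb

      small : length members ≤ℕ size
      small = length-filter S? elems

    sup : Carrier
    sup = ⨆ (fromList members)

    inf : Carrier
    inf = ⨅ (fromList members)

    sup-isSup : IsSup S sup
    sup-isSup = ⨆-isSup members⊆S (λ _ Sb → ∈⇒≤⨆ (S⊆members Sb))

    inf-isInf : IsInf S inf
    inf-isInf = ⨅-isInf members⊆S (λ _ Sb → ∈⇒⨅≤ (S⊆members Sb))

    IsSup⇔smallJoin : ∀ {a} → IsSup S a ⇔ (SmallCombination S ⨆ a × IsUpperBound S a)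
    IsSup⇔smallJoin = mk⇔
      (λ a-sup → (_ , _ , small , IsSup-unique sup-isSup a-sup , members⊆S) , proj₁ a-sup)
      (λ { ((_ , _ , _ , refl , bs⊆S) , ub) → ⨆-isSup bs⊆S ub })

    IsInf⇔smallMeet : ∀ {a} → IsInf S a ⇔ (SmallCombination S ⨅ a × IsLowerBound S a)
    IsInf⇔smallMeet = mk⇔
      (λ a-inf → (_ , _ , small , IsInf-unique inf-isInf a-inf , members⊆S) , proj₁ a-inf)
      (λ { ((_ , _ , _ , refl , bs⊆S) , lb) → ⨅-isInf bs⊆S lb })

module Evaluation (em : ExcludedMiddle 0ℓ) (A : LatticeAlgebra) (F : Frame) {X : Set}
                  (V : X → W F → CarrierOf A) where
  open LatticeAlgebra A
  open LatticeOrder A using (sup; inf; sup-isSup; inf-isInf)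

  mutual
    evaluate : Fm A X → W F → Carrier
    evaluate (var x)   w = V x w
    evaluate (φ ∧ᶠ ψ)  w = evaluate φ w ∧ evaluate ψ w
    evaluate (φ ∨ᶠ ψ)  w = evaluate φ w ∨ evaluate ψ w
    evaluate (op o φs) w = ⟦ o ⟧ (evaluateV φs w)
    evaluate (◇ φ)     w = sup em (λ a → ∃ λ v → R F w v × evaluate φ v ≡ a)
    evaluate (□ φ)     w = inf em (λ a → ∃ λ v → R F w v × evaluate φ v ≡ a)

    evaluateV : ∀ {n} → Vec (Fm A X) n → W F → Vec Carrier n
    evaluateV []       w = []
    evaluateV (φ ∷ φs) w = evaluate φ w ∷ evaluateV φs w

  evaluateV-map : ∀ {n} (φs : Vec (Fm A X) n) w → evaluateV φs w ≡ Vec.map (λ φ → evaluate φ w) φs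
  evaluateV-map []       w = refl
  evaluateV-map (φ ∷ φs) w = cong (evaluate φ w ∷_) (evaluateV-map φs w)

  evaluate-isEvaluation : IsEvaluation A F V evaluate
  evaluate-isEvaluation = record
    { ev-var = λ _ _ → refl
    ; ev-∧   = λ _ _ _ → refl
    ; ev-∨   = λ _ _ _ → refl
    ; ev-op  = λ o φs w → cong ⟦ o ⟧ (evaluateV-map φs w)
    ; ev-◇   = λ _ _ → sup-isSup em _
    ; ev-□   = λ _ _ → inf-isInf em _
    }

T-not : ∀ {x} → T (not x) ⇔ (¬ T x)
T-not {false} = mk⇔ (λ _ ()) (λ _ → tt)
T-not {true}  = mk⇔ (λ ()) (λ ¬t → ¬t tt)

T-implies : ∀ {x y} → T (not x ∨ᵇ y) ⇔ (T x → T y)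
T-implies {false} = mk⇔ (λ _ ()) (λ _ → tt)
T-implies {true}  = mk⇔ (λ t _ → t) (λ f → f tt)

T-iff : ∀ {x y} → T (if x then y else not y) ⇔ (T x ⇔ T y)
T-iff {false} {false} = mk⇔ (λ _ → mk⇔ (λ ()) (λ ())) (λ _ → tt)
T-iff {false} {true}  = mk⇔ (λ ()) (λ t → from t tt)
T-iff {true}          = mk⇔ (λ t → mk⇔ (λ _ → t) (λ _ → tt)) (λ t → to t tt)

module ClassicalSemantics (em : ExcludedMiddle 0ℓ) {F : Frame} {X : Set} {V : X → W F → Bool}
                          {ev : Fm 𝟚 X → W F → Bool} (isEv : IsEvaluation 𝟚 F V ev) where
  open IsEvaluation isEv
  open LatticeAlgebra 𝟚 using (IsUpperBound; IsLowerBound)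

  infix 4 _⊩_ _⊩*_

  _⊩_ : W F → Fm 𝟚 X → Set
  w ⊩ χ = T (ev χ w)

  _⊩*_ : W F → List (Fm 𝟚 X) → Set
  w ⊩* L = ∀ {χ} → χ ∈ L → w ⊩ χ

  module _ {w : W F} where

    ⊩-⊤ : w ⊩ ⊤ᶜ
    ⊩-⊤ = subst T (sym (ev-op ⊤ᵒ [] w)) tt

    ⊩-⊥ : ¬ w ⊩ ⊥ᶜ
    ⊩-⊥ = subst T (ev-op ⊥ᵒ [] w)

    ⊩-∧ : ∀ {φ ψ} → w ⊩ φ ∧ᶠ ψ ⇔ (w ⊩ φ × w ⊩ ψ)
    ⊩-∧ {φ} {ψ} rewrite ev-∧ φ ψ w = T-∧

    ⊩-∨ : ∀ {φ ψ} → w ⊩ φ ∨ᶠ ψ ⇔ (w ⊩ φ ⊎ w ⊩ ψ)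
    ⊩-∨ {φ} {ψ} rewrite ev-∨ φ ψ w = T-∨

    ⊩-¬ : ∀ {φ} → w ⊩ ¬ᶜ φ ⇔ (¬ w ⊩ φ)
    ⊩-¬ {φ} rewrite ev-op ¬ᵒ (φ ∷ []) w = T-not

    ⊩-⇒ : ∀ {φ ψ} → w ⊩ φ ⇒ᶜ ψ ⇔ (w ⊩ φ → w ⊩ ψ)
    ⊩-⇒ {φ} {ψ} rewrite ev-op ⇒ᵒ (φ ∷ ψ ∷ []) w = T-implies

    ⊩-⇔ : ∀ {φ ψ} → w ⊩ φ ⇔ᶜ ψ ⇔ (w ⊩ φ ⇔ w ⊩ ψ)
    ⊩-⇔ {φ} {ψ} rewrite ev-op ⇔ᵒ (φ ∷ ψ ∷ []) w = T-iff

    ⊩-◇ : ∀ {φ} → w ⊩ ◇ φ ⇔ (∃ λ u → R F w u × u ⊩ φ)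
    ⊩-◇ {φ} = mk⇔ witness (λ (u , wRu , u⊩φ) → upper u wRu u⊩φ)
      where
      upper : ∀ u → R F w u → u ⊩ φ → w ⊩ ◇ φ
      upper u wRu u⊩φ with ev φ u | proj₁ (ev-◇ φ w) (ev φ u) (u , wRu , refl)
      ... | true | ◇φ-true = subst T (sym ◇φ-true) tt
      witness : w ⊩ ◇ φ → ∃ λ u → R F w u × u ⊩ φ
      witness w⊩◇φ with em {∃ λ u → R F w u × u ⊩ φ}
      ... | yes found = found
      ... | no none = ⊥-elim (subst T ◇φ-false w⊩◇φ)
        where
        false-bounds : IsUpperBound (λ b → ∃ λ u → R F w u × ev φ u ≡ b) false
        false-bounds true  (u , wRu , u⊩φ) = ⊥-elim (none (u , wRu , subst T (sym u⊩φ) tt))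
        false-bounds false _                = refl
        ◇φ-false : ev (◇ φ) w ≡ false
        ◇φ-false = trans (sym (proj₂ (ev-◇ φ w) false false-bounds)) (∧-zeroʳ _)

    ⊩-□ : ∀ {φ} → w ⊩ □ φ ⇔ (∀ {u} → R F w u → u ⊩ φ)
    ⊩-□ {φ} = mk⇔ lower (λ all → subst T (greatest all) tt)
      where
      lower : w ⊩ □ φ → ∀ {u} → R F w u → u ⊩ φ
      lower w⊩□φ {u} wRu with ev (□ φ) w | proj₁ (ev-□ φ w) (ev φ u) (u , wRu , refl)
      ... | true | φ-true = subst T (sym φ-true) tt
      greatest : (∀ {u} → R F w u → u ⊩ φ) → true ≡ ev (□ φ) w
      greatest all = sym (proj₂ (ev-□ φ w) true true-bounds)
        where
        true-bounds : IsLowerBound (λ b → ∃ λ u → R F w u × ev φ u ≡ b) true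
        true-bounds b (u , wRu , refl) with ev φ u | all wRu
        ... | true | _ = refl

  ⊩*-∷ : ∀ {w χ L} → w ⊩* (χ ∷ L) ⇔ (w ⊩ χ × w ⊩* L)
  ⊩*-∷ = mk⇔ (λ all → all (here refl) , λ {χ′} χ′∈ → all (there χ′∈))
             (λ { (w⊩χ , _) (here refl) → w⊩χ ; (_ , all) (there χ′∈) → all χ′∈ })

  ⊩-⋀ : ∀ {L w} → w ⊩ ⋀ L ⇔ w ⊩* L
  ⊩-⋀ = mk⇔ (⊩-⋀⁻ _) (⊩-⋀⁺ _)
    where
    ⊩-⋀⁻ : ∀ L {w} → w ⊩ ⋀ L → w ⊩* L
    ⊩-⋀⁻ (χ ∷ [])    w⊩ (here refl) = w⊩
    ⊩-⋀⁻ (χ ∷ ψ ∷ L) w⊩ (here refl) = proj₁ (to ⊩-∧ w⊩)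
    ⊩-⋀⁻ (χ ∷ ψ ∷ L) w⊩ (there χ′∈) = ⊩-⋀⁻ (ψ ∷ L) (proj₂ (to ⊩-∧ w⊩)) χ′∈
    ⊩-⋀⁺ : ∀ L {w} → w ⊩* L → w ⊩ ⋀ L
    ⊩-⋀⁺ []          _   = ⊩-⊤
    ⊩-⋀⁺ (χ ∷ [])    all = all (here refl)
    ⊩-⋀⁺ (χ ∷ ψ ∷ L) all = from ⊩-∧ (all (here refl) , ⊩-⋀⁺ (ψ ∷ L) (λ χ′∈ → all (there χ′∈)))

  ⊩-⋁ : ∀ {L w} → w ⊩ ⋁ L ⇔ Any (w ⊩_) L
  ⊩-⋁ = mk⇔ (⊩-⋁⁻ _) (⊩-⋁⁺ _)
    where
    ⊩-⋁⁻ : ∀ L {w} → w ⊩ ⋁ L → Any (w ⊩_) L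
    ⊩-⋁⁻ []          w⊩ = ⊥-elim (⊩-⊥ w⊩)
    ⊩-⋁⁻ (χ ∷ [])    w⊩ = here w⊩
    ⊩-⋁⁻ (χ ∷ ψ ∷ L) w⊩ = [ here , there ∘ ⊩-⋁⁻ (ψ ∷ L) ]′ (to ⊩-∨ w⊩)
    ⊩-⋁⁺ : ∀ L {w} → Any (w ⊩_) L → w ⊩ ⋁ L
    ⊩-⋁⁺ (χ ∷ [])    (here w⊩χ)   = w⊩χ
    ⊩-⋁⁺ (χ ∷ ψ ∷ L) (here w⊩χ)   = from ⊩-∨ (inj₁ w⊩χ)
    ⊩-⋁⁺ (χ ∷ ψ ∷ L) (there w⊩ψs) = from ⊩-∨ (inj₂ (⊩-⋁⁺ (ψ ∷ L) w⊩ψs))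

  ⊩-⋁-map : ∀ {B : Set} {f : B → Fm 𝟚 X} {xs w} → w ⊩ ⋁ (map f xs) ⇔ (∃ λ x → x ∈ xs × w ⊩ f x)
  ⊩-⋁-map = ⇔-trans ⊩-⋁ (mk⇔ (find ∘ AnyP.map⁻) (AnyP.map⁺ ∘ uncurry lose ∘ proj₂))

  ⊩-⋁-filter : ∀ {B : Set} {f : B → Fm 𝟚 X} {P : Pred B 0ℓ} (P? : Decidable P) {xs w} →
               w ⊩ ⋁ (map f (filter P? xs)) ⇔ (∃ λ x → (x ∈ xs × P x) × w ⊩ f x)
  ⊩-⋁-filter P? {xs} = ⇔-trans ⊩-⋁-map (mk⇔
    (λ (x , x∈ , w⊩) → x , ∈-filter⁻ P? {xs = xs} x∈ , w⊩)
    (λ (x , (x∈ , Px) , w⊩) → x , ∈-filter⁺ P? x∈ Px , w⊩))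

  ⊩-□^ : ∀ m {χ v} → v ⊩ □^ m χ ⇔ (∀ {u} → Reachable F m v u → u ⊩ χ)
  ⊩-□^ zero    = mk⇔ (λ { v⊩χ refl → v⊩χ }) (λ all → all refl)
  ⊩-□^ (suc m) = mk⇔
    (λ v⊩ {u} (x , vRx , path) → to (⊩-□^ m) (to ⊩-□ v⊩ vRx) path)
    (λ all → from ⊩-□ (λ vRx → from (⊩-□^ m) (λ path → all (_ , vRx , path))))

  ⊩-boxes : ∀ {r χ v} → v ⊩ ⋀ (map (λ m → □^ m χ) (upTo (suc r))) ⇔ WithinSteps F r (_⊩ χ) v
  ⊩-boxes {r} {χ} {v} = ⇔-trans ⊩-⋀ (mk⇔ unboxed boxed)
    where
    unboxed : v ⊩* map (λ m → □^ m χ) (upTo (suc r)) → WithinSteps F r (_⊩ χ) v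
    unboxed all m≤r = to (⊩-□^ _) (all (∈-map⁺ (λ m → □^ m χ) (∈-upTo⁺ (s≤s m≤r))))
    boxed : WithinSteps F r (_⊩ χ) v → v ⊩* map (λ m → □^ m χ) (upTo (suc r))
    boxed within □χ∈ with m , m∈ , refl ← ∈-map⁻ (λ m → □^ m χ) □χ∈ =
      from (⊩-□^ m) (within (≤-pred (∈-upTo⁻ m∈)))

module TranslationLists (A : LatticeAlgebra) where
  open LatticeAlgebra A
  open Translation A

  ∈-pairs : ∀ {b₁ b₂} → (b₁ , b₂) ∈ pairs
  ∈-pairs = ∈-concatMap⁺ _ (lose (complete _) (∈-map⁺ _ (complete _)))

  ∈-tuples : ∀ {k} (bs : Vec Carrier k) → bs ∈ tuples k
  ∈-tuples []       = here refl
  ∈-tuples (b ∷ bs) = ∈-concatMap⁺ _ (lose (complete b) (∈-map⁺ (b ∷_) (∈-tuples bs)))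

  ∈-smallTuples : ∀ {k} {bs : Vec Carrier k} → (k , bs) ∈ smallTuples ⇔ k ≤ℕ size
  ∈-smallTuples {k} {bs} = mk⇔ small λ k≤size →
    ∈-concatMap⁺ tuplesOfLength (lose (∈-upTo⁺ (s≤s k≤size)) (∈-map⁺ (k ,_) (∈-tuples bs)))
    where
    tuplesOfLength : ℕ → List (Σ ℕ (Vec Carrier))
    tuplesOfLength k = map (k ,_) (tuples k)
    small : (k , bs) ∈ smallTuples → k ≤ℕ size
    small kbs∈ with k′ , k′∈ , kbs∈′ ← find (∈-concatMap⁻ tuplesOfLength {xs = upTo (suc size)} kbs∈)
               with _ , _ , refl ← ∈-map⁻ (k′ ,_) kbs∈′ = ≤-pred (∈-upTo⁻ k′∈)

  constraintsOf : List (Fm A τ) → List τ → List (Fm 𝟚 τ*)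
  constraintsOf Ls Lv = concatMap TFor Lv ++ concatMap E Ls

  constraints : Fm A τ → List (Fm 𝟚 τ*)
  constraints θ = constraintsOf (subs θ) (vars θ)

  module _ {Ls : List (Fm A τ)} {Lv : List τ} where

    TFor⊆constraintsOf : ∀ {p} → p ∈ Lv → TFor p ⊆ constraintsOf Ls Lv
    TFor⊆constraintsOf p∈ χ∈ = ∈-++⁺ˡ (∈-concatMap⁺ TFor (lose p∈ χ∈))

    E⊆constraintsOf : ∀ {ψ} → ψ ∈ Ls → E ψ ⊆ constraintsOf Ls Lv
    E⊆constraintsOf ψ∈ χ∈ = ∈-++⁺ʳ (concatMap TFor Lv) (∈-concatMap⁺ E (lose ψ∈ χ∈))

    ∈-constraintsOf⁻ : ∀ {χ} → χ ∈ constraintsOf Ls Lv →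
                       (∃ λ p → p ∈ Lv × χ ∈ TFor p) ⊎ (∃ λ ψ → ψ ∈ Ls × χ ∈ E ψ)
    ∈-constraintsOf⁻ χ∈ with ∈-++⁻ (concatMap TFor Lv) χ∈
    ... | inj₁ χ∈TFor = inj₁ (find (∈-concatMap⁻ TFor {xs = Lv} χ∈TFor))
    ... | inj₂ χ∈E    = inj₂ (find (∈-concatMap⁻ E {xs = Ls} χ∈E))

module Faithfulness (em : ExcludedMiddle 0ℓ) (A : LatticeAlgebra) {F : Frame}
  {V : ℕ → W F → CarrierOf A} {ev : Fm A ℕ → W F → CarrierOf A} (isEv : IsEvaluation A F V ev)
  {V* : Translation.τ* A → W F → Bool} {ev* : Fm 𝟚 (Translation.τ* A) → W F → Bool}
  (isEv* : IsEvaluation 𝟚 F V* ev*) where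
  open LatticeAlgebra A
  open LatticeOrder A
  open Translation A
  open TranslationLists A
  open IsEvaluation isEv
  open ClassicalSemantics em isEv* public

  Faithful : Fm A τ → W F → Set
  Faithful ψ v = ∀ b → v ⊩ q b ψ ⇔ ev ψ v ≡ b

  SuccessorsFaithful : Fm A τ → W F → Set
  SuccessorsFaithful χ v = ∀ {u} → R F v u → Faithful χ u

  -- E (var p) is empty, so ⊩-E⇔Faithful below must exclude variables.
  ChildrenFaithful : Fm A τ → W F → Set
  ChildrenFaithful (var _)    v = ⊥
  ChildrenFaithful (ψ₁ ∧ᶠ ψ₂) v = Faithful ψ₁ v × Faithful ψ₂ v
  ChildrenFaithful (ψ₁ ∨ᶠ ψ₂) v = Faithful ψ₁ v × Faithful ψ₂ v
  ChildrenFaithful (op _ ψs)  v = All (λ ψ → Faithful ψ v) ψs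
  ChildrenFaithful (◇ χ)      v = SuccessorsFaithful χ v
  ChildrenFaithful (□ χ)      v = SuccessorsFaithful χ v

  SuccessorValues : Fm A τ → W F → Pred Carrier 0ℓ
  SuccessorValues χ v b = ∃ λ u → R F v u × ev χ u ≡ b

  ∀-SuccessorValues : ∀ {χ v} {P : Pred Carrier 0ℓ} →
                      (∀ b → SuccessorValues χ v b → P b) ⇔ (∀ {u} → R F v u → P (ev χ u))
  ∀-SuccessorValues = mk⇔ (λ all {u} vRu → all _ (u , vRu , refl))
                          (λ { all _ (_ , vRu , refl) → all vRu })

  ⊩-pairs : ∀ (_⊙_ : Carrier → Carrier → Carrier) {ψ₁ ψ₂ ψ v} → ev ψ v ≡ ev ψ₁ v ⊙ ev ψ₂ v →
            Faithful ψ₁ v → Faithful ψ₂ v → ∀ a →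
            v ⊩ ⋁ (map (λ bb → q (proj₁ bb) ψ₁ ∧ᶠ q (proj₂ bb) ψ₂)
                       (filter (λ bb → (proj₁ bb ⊙ proj₂ bb) ≟ a) pairs))
              ⇔ ev ψ v ≡ a
  ⊩-pairs _⊙_ {ψ₁} {ψ₂} {ψ} {v} ev-ψ f₁ f₂ a = ⇔-trans (⊩-⋁-filter _) (mk⇔
    (λ { ((b₁ , b₂) , (_ , b₁⊙b₂≡a) , v⊩) → let v⊩₁ , v⊩₂ = to ⊩-∧ v⊩ in begin
           ev ψ v                ≡⟨ ev-ψ ⟩
           ev ψ₁ v ⊙ ev ψ₂ v     ≡⟨ cong₂ _⊙_ (to (f₁ b₁) v⊩₁) (to (f₂ b₂) v⊩₂) ⟩
           b₁ ⊙ b₂               ≡⟨ b₁⊙b₂≡a ⟩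
           a                     ∎ })
    (λ ev-ψ≡a → _ , (∈-pairs , trans (sym ev-ψ) ev-ψ≡a) ,
                from ⊩-∧ (from (f₁ _) refl , from (f₂ _) refl)))
    where open ≡-Reasoning

  ⊩-qs : ∀ {n} (bs : Vec Carrier n) {ψs : Vec (Fm A τ) n} {v} → All (λ ψ → Faithful ψ v) ψs →
         v ⊩ ⋀ (qs bs ψs) ⇔ Vec.map (λ ψ → ev ψ v) ψs ≡ bs
  ⊩-qs []       {[]}     []       = mk⇔ (λ _ → refl) (λ _ → ⊩-⊤)
  ⊩-qs (b ∷ bs) {ψ ∷ ψs} {v} (f ∷ fs) = begin
    v ⊩ ⋀ (q b ψ ∷ qs bs ψs)                          ∼⟨ ⊩-⋀ ⟩
    v ⊩* (q b ψ ∷ qs bs ψs)                           ∼⟨ ⊩*-∷ ⟩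
    (v ⊩ q b ψ × v ⊩* qs bs ψs)                       ∼⟨ f b ×-⇔ ⇔-trans (⇔-sym ⊩-⋀) (⊩-qs bs fs) ⟩
    (ev ψ v ≡ b × Vec.map (λ ψ → ev ψ v) ψs ≡ bs)     ∼⟨ mk⇔ (uncurry (cong₂ _∷_)) ∷-injective ⟩
    Vec.map (λ ψ → ev ψ v) (ψ ∷ ψs) ≡ b ∷ bs          ∎
    where open EquationalReasoning

  ⊩-tuples : ∀ o {ψs : Vec (Fm A τ) (arity A o)} {v} → All (λ ψ → Faithful ψ v) ψs → ∀ a →
             v ⊩ ⋁ (map (λ bs → ⋀ (qs bs ψs)) (filter (λ bs → ⟦ o ⟧ bs ≟ a) (tuples (arity A o))))
               ⇔ ev (op o ψs) v ≡ a
  ⊩-tuples o {ψs} {v} fs a = ⇔-trans (⊩-⋁-filter _) (mk⇔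
    (λ { (bs , (_ , ⟦o⟧bs≡a) , v⊩) →
           trans (ev-op o ψs v) (trans (cong ⟦ o ⟧ (to (⊩-qs bs fs) v⊩)) ⟦o⟧bs≡a) })
    (λ ev≡a → _ , (∈-tuples _ , trans (sym (ev-op o ψs v)) ev≡a) , from (⊩-qs _ fs) refl))

  module _ {χ : Fm A τ} {v : W F} (children : SuccessorsFaithful χ v) where

    ⊩-◇qs : ∀ {k} (bs : Vec Carrier k) → v ⊩ ⋀ (◇qs bs χ) ⇔ All (SuccessorValues χ v) bs
    ⊩-◇qs []       = mk⇔ (λ _ → []) (λ _ → ⊩-⊤)
    ⊩-◇qs (b ∷ bs) = begin
      v ⊩ ⋀ (◇ (q b χ) ∷ ◇qs bs χ)                         ∼⟨ ⇔-trans ⊩-⋀ ⊩*-∷ ⟩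
      (v ⊩ ◇ (q b χ) × v ⊩* ◇qs bs χ)                      ∼⟨ ⊩-◇ ×-⇔ ⇔-trans (⇔-sym ⊩-⋀) (⊩-◇qs bs) ⟩
      ((∃ λ u → R F v u × u ⊩ q b χ) × All (SuccessorValues χ v) bs)
                                                           ∼⟨ successor ×-⇔ ⇔-refl ⟩
      (SuccessorValues χ v b × All (SuccessorValues χ v) bs) ∼⟨ mk⇔ (uncurry _∷_) All.uncons ⟩
      All (SuccessorValues χ v) (b ∷ bs)                   ∎
      where
      open EquationalReasoning
      successor : (∃ λ u → R F v u × u ⊩ q b χ) ⇔ SuccessorValues χ v b
      successor = mk⇔ (λ (u , vRu , u⊩) → u , vRu , to (children vRu b) u⊩)
                      (λ (u , vRu , ev≡b) → u , vRu , from (children vRu b) ev≡b)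

    ⊩-smallCombination : ∀ (⨀ : ∀ {k} → Vec Carrier k → Carrier) a →
      v ⊩ ⋁ (map (λ kbs → ⋀ (◇qs (proj₂ kbs) χ)) (filter (λ kbs → ⨀ (proj₂ kbs) ≟ a) smallTuples))
        ⇔ SmallCombination (SuccessorValues χ v) ⨀ a
    ⊩-smallCombination ⨀ a = ⇔-trans (⊩-⋁-filter (λ kbs → ⨀ (proj₂ kbs) ≟ a)) (mk⇔
      (λ { ((k , bs) , (kbs∈ , ⨀bs≡a) , v⊩) →
             k , bs , to ∈-smallTuples kbs∈ , ⨀bs≡a , to (⊩-◇qs bs) v⊩ })
      (λ (k , bs , k≤size , ⨀bs≡a , bs⊆) →
         (k , bs) , (from ∈-smallTuples k≤size , ⨀bs≡a) , from (⊩-◇qs bs) bs⊆))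

    ⊩-□-bounded : ∀ {P : Pred Carrier 0ℓ} (P? : Decidable P) →
      v ⊩ □ (⋁ (map (λ b → q b χ) (filter P? elems))) ⇔ (∀ {u} → R F v u → P (ev χ u))
    ⊩-□-bounded {P} P? = ⇔-trans ⊩-□ (mk⇔
      (λ all {u} vRu → bounded vRu (to (⊩-⋁-filter P?) (all vRu)))
      (λ all {u} vRu →
         from (⊩-⋁-filter P?) (ev χ u , (complete _ , all vRu) , from (children vRu _) refl)))
      where
      bounded : ∀ {u} → R F v u → (∃ λ b → (b ∈ elems × P b) × u ⊩ q b χ) → P (ev χ u)
      bounded vRu (b , (_ , Pb) , u⊩) = subst P (sym (to (children vRu b) u⊩)) Pb

    ⊩-◇-definiens : ∀ a →
      v ⊩ ⋁ (map (λ kbs → ⋀ (◇qs (proj₂ kbs) χ)) (filter (λ kbs → ⨆ (proj₂ kbs) ≟ a) smallTuples))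
          ∧ᶠ □ (⋁ (map (λ b → q b χ) (filter (λ b → b ≤? a) elems)))
        ⇔ ev (◇ χ) v ≡ a
    ⊩-◇-definiens a = begin
      (v ⊩ _ ∧ᶠ _)                                     ∼⟨ ⊩-∧ ⟩
      (v ⊩ _ × v ⊩ _)                                  ∼⟨ ⊩-smallCombination ⨆ a ×-⇔ ⊩-□-bounded (_≤? a) ⟩
      (SmallCombination S ⨆ a × (∀ {u} → R F v u → ev χ u ≤ a))
                                                       ∼⟨ ⇔-refl ×-⇔ ⇔-sym ∀-SuccessorValues ⟩
      (SmallCombination S ⨆ a × IsUpperBound S a)      ∼⟨ ⇔-sym (IsSup⇔smallJoin em S) ⟩
      IsSup S a                                        ∼⟨ ⇔-sym (IsSup-≡ (ev-◇ χ v)) ⟩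
      ev (◇ χ) v ≡ a                                   ∎
      where
      open EquationalReasoning
      S : Pred Carrier 0ℓ
      S = SuccessorValues χ v

    ⊩-□-definiens : ∀ a →
      v ⊩ ⋁ (map (λ kbs → ⋀ (◇qs (proj₂ kbs) χ)) (filter (λ kbs → ⨅ (proj₂ kbs) ≟ a) smallTuples))
          ∧ᶠ □ (⋁ (map (λ b → q b χ) (filter (λ b → a ≤? b) elems)))
        ⇔ ev (□ χ) v ≡ a
    ⊩-□-definiens a = begin
      (v ⊩ _ ∧ᶠ _)                                     ∼⟨ ⊩-∧ ⟩
      (v ⊩ _ × v ⊩ _)                                  ∼⟨ ⊩-smallCombination ⨅ a ×-⇔ ⊩-□-bounded (a ≤?_) ⟩
      (SmallCombination S ⨅ a × (∀ {u} → R F v u → a ≤ ev χ u))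
                                                       ∼⟨ ⇔-refl ×-⇔ ⇔-sym ∀-SuccessorValues ⟩
      (SmallCombination S ⨅ a × IsLowerBound S a)      ∼⟨ ⇔-sym (IsInf⇔smallMeet em S) ⟩
      IsInf S a                                        ∼⟨ ⇔-sym (IsInf-≡ (ev-□ χ v)) ⟩
      ev (□ χ) v ≡ a                                   ∎
      where
      open EquationalReasoning
      S : Pred Carrier 0ℓ
      S = SuccessorValues χ v

  ⊩*-biconditionals : ∀ {ψ v} {δ : Carrier → Fm 𝟚 τ*} → (∀ a → v ⊩ δ a ⇔ ev ψ v ≡ a) →
                      v ⊩* map (λ a → q a ψ ⇔ᶜ δ a) elems ⇔ Faithful ψ v
  ⊩*-biconditionals {ψ} {v} {δ} δ-correct = mk⇔
    (λ all b → ⇔-trans (to ⊩-⇔ (all (∈-map⁺ _ (complete b)))) (δ-correct b))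
    biconditionals
    where
    biconditionals : Faithful ψ v → v ⊩* map (λ a → q a ψ ⇔ᶜ δ a) elems
    biconditionals faithful χ∈ with a , _ , refl ← ∈-map⁻ _ χ∈ =
      from ⊩-⇔ (⇔-trans (faithful a) (⇔-sym (δ-correct a)))

  -- For compound ψ, E ψ unfolds to the biconditionals q a ψ ⇔ᶜ δ a, and δ is found by
  -- unification; Defs' pattern lambdas on (k , bs) agree definitionally with the projection
  -- forms used above, by η for Σ.
  ⊩-E⇔Faithful : ∀ ψ {v} → ChildrenFaithful ψ v → v ⊩* E ψ ⇔ Faithful ψ v
  ⊩-E⇔Faithful (var _)    ()
  ⊩-E⇔Faithful (ψ₁ ∧ᶠ ψ₂) (f₁ , f₂) = ⊩*-biconditionals (⊩-pairs _∧_ (ev-∧ ψ₁ ψ₂ _) f₁ f₂)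
  ⊩-E⇔Faithful (ψ₁ ∨ᶠ ψ₂) (f₁ , f₂) = ⊩*-biconditionals (⊩-pairs _∨_ (ev-∨ ψ₁ ψ₂ _) f₁ f₂)
  ⊩-E⇔Faithful (op o ψs)  fs        = ⊩*-biconditionals (⊩-tuples o fs)
  ⊩-E⇔Faithful (◇ χ)      children  = ⊩*-biconditionals (⊩-◇-definiens children)
  ⊩-E⇔Faithful (□ χ)      children  = ⊩*-biconditionals (⊩-□-definiens children)

  ⊩-TFor : ∀ {p v} → v ⊩* TFor p ⇔ ∃! _≡_ (λ a → v ⊩ q a (var p))
  ⊩-TFor {p} {v} = ⇔-trans ⊩*-∷ (mk⇔ uniqueValue exactlyOne)
    where
    Value : Pred Carrier 0ℓ
    Value a = v ⊩ q a (var p)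
    exclusionsFrom : Carrier → List (Fm 𝟚 τ*)
    exclusionsFrom a = map (λ b → ¬ᶜ (q a (var p) ∧ᶠ q b (var p))) (filter (λ b → ¬? (a ≟ b)) elems)
    exclusions : List (Fm 𝟚 τ*)
    exclusions = concatMap exclusionsFrom elems
    uniqueValue : v ⊩ ⋁ (map (λ a → q a (var p)) elems) × v ⊩* exclusions → ∃! _≡_ Value
    uniqueValue (v⊩⋁ , v⊩exclusions) with a , _ , va ← to (⊩-⋁-map {xs = elems}) v⊩⋁ =
      a , va , λ {b} vb → decidable-stable (a ≟ b) λ a≢b →
        to ⊩-¬ (v⊩exclusions (∈-concatMap⁺ exclusionsFrom
                  (lose (complete a) (∈-map⁺ _ (∈-filter⁺ (λ b → ¬? (a ≟ b)) (complete b) a≢b)))))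
               (from ⊩-∧ (va , vb))
    exactlyOne : ∃! _≡_ Value → v ⊩ ⋁ (map (λ a → q a (var p)) elems) × v ⊩* exclusions
    exactlyOne (a , va , unique) = from (⊩-⋁-map {xs = elems}) (a , complete a , va) , excluded
      where
      excluded : v ⊩* exclusions
      excluded χ∈ with a′ , _ , χ∈′ ← find (∈-concatMap⁻ exclusionsFrom {xs = elems} χ∈)
                  with b′ , b′∈ , refl ← ∈-map⁻ _ χ∈′ =
        from ⊩-¬ λ v⊩ → let va′ , vb′ = to ⊩-∧ v⊩ in
          proj₂ (∈-filter⁻ (λ b → ¬? (a′ ≟ b)) {xs = elems} b′∈)
                (trans (sym (unique va′)) (unique vb′))

module ManyValuedToClassical (em : ExcludedMiddle 0ℓ) (A : LatticeAlgebra) {F : Frame}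
  {V : ℕ → W F → CarrierOf A} {ev : Fm A ℕ → W F → CarrierOf A} (isEv : IsEvaluation A F V ev) where
  open LatticeAlgebra A
  open Translation A
  open TranslationLists A

  indicator : τ* → W F → Bool
  indicator (a , ψ) w = isYes (ev ψ w ≟ a)

  open Evaluation em 𝟚 F indicator public using (evaluate; evaluate-isEvaluation)
  open Faithfulness em A isEv evaluate-isEvaluation public

  faithful : ∀ ψ {v} → Faithful ψ v
  faithful ψ b = mk⇔ toWitness fromWitness

  ⊩-E : ∀ ψ {v} → v ⊩* E ψ
  ⊩-E (var _)      ()
  ⊩-E ψ@(ψ₁ ∧ᶠ ψ₂) = from (⊩-E⇔Faithful ψ (faithful ψ₁ , faithful ψ₂)) (faithful ψ)
  ⊩-E ψ@(ψ₁ ∨ᶠ ψ₂) = from (⊩-E⇔Faithful ψ (faithful ψ₁ , faithful ψ₂)) (faithful ψ)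
  ⊩-E ψ@(op _ ψs)  = from (⊩-E⇔Faithful ψ (All.universal (λ ψ′ → faithful ψ′) ψs)) (faithful ψ)
  ⊩-E ψ@(◇ χ)      = from (⊩-E⇔Faithful ψ (λ _ → faithful χ)) (faithful ψ)
  ⊩-E ψ@(□ χ)      = from (⊩-E⇔Faithful ψ (λ _ → faithful χ)) (faithful ψ)

  ⊩-TFor-everywhere : ∀ p {v} → v ⊩* TFor p
  ⊩-TFor-everywhere p = from ⊩-TFor (_ , from (faithful (var p) _) refl , to (faithful (var p) _))

  ⊩-constraintsOf : ∀ {Ls Lv v} → v ⊩* constraintsOf Ls Lv
  ⊩-constraintsOf {Ls} {Lv} χ∈ with ∈-constraintsOf⁻ {Ls} {Lv} χ∈
  ... | inj₁ (p , _ , χ∈TFor) = ⊩-TFor-everywhere p χ∈TFor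
  ... | inj₂ (ψ , _ , χ∈E)    = ⊩-E ψ χ∈E

module ClassicalToManyValued (em : ExcludedMiddle 0ℓ) (A : LatticeAlgebra) {F : Frame}
  {V* : Translation.τ* A → W F → Bool} {ev* : Fm 𝟚 (Translation.τ* A) → W F → Bool}
  (isEv* : IsEvaluation 𝟚 F V* ev*) where
  open LatticeAlgebra A
  open Translation A
  open TranslationLists A

  choose : ∀ {P : Pred Carrier 0ℓ} → Dec (Any P elems) → Carrier
  choose (yes found) = Any.lookup found
  choose (no _)      = 0A

  choose-satisfies : ∀ {P : Pred Carrier 0ℓ} (P? : Dec (Any P elems)) → Any P elems → P (choose P?)
  choose-satisfies (yes found) _     = lookup-result found
  choose-satisfies (no none)   found = ⊥-elim (none found)

  -- Where T*(p) fails, readOff p is an arbitrary junk value.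
  readOff : τ → W F → Carrier
  readOff p v = choose (any? (λ a → T? (ev* (q a (var p)) v)) elems)

  open Evaluation em A F readOff public using (evaluate; evaluate-isEvaluation)
  open Faithfulness em A evaluate-isEvaluation isEv* public

  faithful-var : ∀ {p v} → v ⊩* TFor p → Faithful (var p) v
  faithful-var {p} {v} v⊩TFor b with a , va , unique ← to ⊩-TFor v⊩TFor = mk⇔
    (λ vb → trans (sym (unique read)) (unique vb))
    (λ { refl → read })
    where
    read : v ⊩ q (readOff p v) (var p)
    read = choose-satisfies (any? (λ a → T? (ev* (q a (var p)) v)) elems) (lose (complete a) va)

  module _ {Ls : List (Fm A τ)} {Lv : List τ} where

    Constrained : ℕ → W F → Set
    Constrained r = WithinSteps F r (_⊩* constraintsOf Ls Lv)

    ⊩-E-here : ∀ {ψ r v} → ψ ∈ Ls → Constrained r v → v ⊩* E ψ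
    ⊩-E-here ψ∈ h χ∈ = WithinSteps-here h (E⊆constraintsOf {Ls} {Lv} ψ∈ χ∈)

    faithful-step : ∀ ψ {r v} → ψ ∈ Ls → Constrained r v → ChildrenFaithful ψ v → Faithful ψ v
    faithful-step ψ ψ∈ h children = to (⊩-E⇔Faithful ψ children) (⊩-E-here ψ∈ h)

    mutual
      faithful-near : ∀ ψ {v} → subs ψ ⊆ Ls → vars ψ ⊆ Lv → Constrained (rank ψ) v → Faithful ψ v
      faithful-near (var p) _ vars⊆ h =
        faithful-var (λ χ∈ → WithinSteps-here h (TFor⊆constraintsOf {Ls} {Lv} (vars⊆ (here refl)) χ∈))
      faithful-near ψ@(ψ₁ ∧ᶠ ψ₂) subs⊆ vars⊆ h = faithful-step ψ (subs⊆ (here refl)) h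
        (faithful-near₂ ψ₁ ψ₂ (λ ψ′∈ → subs⊆ (there ψ′∈)) vars⊆ h)
      faithful-near ψ@(ψ₁ ∨ᶠ ψ₂) subs⊆ vars⊆ h = faithful-step ψ (subs⊆ (here refl)) h
        (faithful-near₂ ψ₁ ψ₂ (λ ψ′∈ → subs⊆ (there ψ′∈)) vars⊆ h)
      faithful-near ψ@(op _ ψs)  subs⊆ vars⊆ h = faithful-step ψ (subs⊆ (here refl)) h
        (faithful-nearV ψs (λ ψ′∈ → subs⊆ (there ψ′∈)) vars⊆ h)
      faithful-near ψ@(◇ χ)      subs⊆ vars⊆ h = faithful-step ψ (subs⊆ (here refl)) h
        (λ vRu → faithful-near χ (λ ψ′∈ → subs⊆ (there ψ′∈)) vars⊆ (WithinSteps-step vRu h))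
      faithful-near ψ@(□ χ)      subs⊆ vars⊆ h = faithful-step ψ (subs⊆ (here refl)) h
        (λ vRu → faithful-near χ (λ ψ′∈ → subs⊆ (there ψ′∈)) vars⊆ (WithinSteps-step vRu h))

      faithful-near₂ : ∀ ψ₁ ψ₂ {v} → subs ψ₁ ++ subs ψ₂ ⊆ Ls → vars ψ₁ ++ vars ψ₂ ⊆ Lv →
                       Constrained (rank ψ₁ ⊔ rank ψ₂) v → Faithful ψ₁ v × Faithful ψ₂ v
      faithful-near₂ ψ₁ ψ₂ subs⊆ vars⊆ h =
        faithful-near ψ₁ (λ ψ′∈ → subs⊆ (∈-++⁺ˡ ψ′∈)) (λ p∈ → vars⊆ (∈-++⁺ˡ p∈))
                      (WithinSteps-≤ (m≤m⊔n _ _) h) ,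
        faithful-near ψ₂ (λ ψ′∈ → subs⊆ (∈-++⁺ʳ (subs ψ₁) ψ′∈)) (λ p∈ → vars⊆ (∈-++⁺ʳ (vars ψ₁) p∈))
                      (WithinSteps-≤ (m≤n⊔m (rank ψ₁) _) h)

      faithful-nearV : ∀ {n} (ψs : Vec (Fm A τ) n) {v} → subsV ψs ⊆ Ls → varsV ψs ⊆ Lv →
                       Constrained (rankV ψs) v → All (λ ψ → Faithful ψ v) ψs
      faithful-nearV []       _     _     _ = []
      faithful-nearV (ψ ∷ ψs) subs⊆ vars⊆ h =
        faithful-near ψ (λ ψ′∈ → subs⊆ (∈-++⁺ˡ ψ′∈)) (λ p∈ → vars⊆ (∈-++⁺ˡ p∈))
                      (WithinSteps-≤ (m≤m⊔n _ _) h) ∷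
        faithful-nearV ψs (λ ψ′∈ → subs⊆ (∈-++⁺ʳ (subs ψ) ψ′∈)) (λ p∈ → vars⊆ (∈-++⁺ʳ (vars ψ) p∈))
                       (WithinSteps-≤ (m≤n⊔m (rank ψ) _) h)

module Transfer (em : ExcludedMiddle 0ℓ) (A : LatticeAlgebra) (𝔽 : Pred Frame 0ℓ) where
  open LatticeAlgebra A using (1A)
  open Translation A
  open TranslationLists A

  classical⇒manyValued : ∀ {Γ φ} {Th : Pred (Fm 𝟚 τ*) 0ℓ} → (∀ {χ} → Th χ → Theory₁ Γ χ) →
                         Consequence 𝔽 𝟚 τ* Th (q 1A φ) → Consequence 𝔽 A ℕ Γ φ
  classical⇒manyValued {Γ} {φ} {Th} Th⊆Theory₁ entails F F∈𝔽 V ev isEv Γ-valid w =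
    to (faithful φ 1A) (from T-≡ (entails F F∈𝔽 indicator evaluate evaluate-isEvaluation Th-valid w))
    where
    open ManyValuedToClassical em A isEv
    Th-valid : ∀ χ → Th χ → ∀ u → evaluate χ u ≡ true
    Th-valid χ Thχ u with Th⊆Theory₁ Thχ
    ... | inj₁ (θ , Γθ , refl)   = to T-≡ (from (faithful θ 1A) (Γ-valid θ Γθ u))
    ... | inj₂ (inj₁ (p , χ∈))   = to T-≡ (⊩-TFor-everywhere p χ∈)
    ... | inj₂ (inj₂ (ψ , χ∈))   = to T-≡ (⊩-E ψ χ∈)

  manyValued⇒classical : ∀ {Γ φ} {Th : Pred (Fm 𝟚 τ*) 0ℓ} → (∀ {θ} → Γ θ → Th (q 1A θ)) →
                         (∀ {θ} → Γ θ ⊎ θ ≡ φ → ∀ {χ} → χ ∈ constraints θ → Th χ) →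
                         Consequence 𝔽 A ℕ Γ φ → Consequence 𝔽 𝟚 τ* Th (q 1A φ)
  manyValued⇒classical {Γ} {φ} {Th} Γ⊆Th constraints⊆Th entails F F∈𝔽 V* ev* isEv* Th-valid w =
    to T-≡ (from (faithful (inj₂ refl) 1A)
                 (entails F F∈𝔽 readOff evaluate evaluate-isEvaluation Γ-valid w))
    where
    open ClassicalToManyValued em A isEv*
    faithful : ∀ {θ} → Γ θ ⊎ θ ≡ φ → ∀ {v} → Faithful θ v
    faithful {θ} θ∈ = faithful-near θ id id λ _ _ χ∈ → from T-≡ (Th-valid _ (constraints⊆Th θ∈ χ∈) _)
    Γ-valid : ∀ θ → Γ θ → ∀ u → evaluate θ u ≡ 1A
    Γ-valid θ Γθ u = to (faithful (inj₁ Γθ) 1A) (from T-≡ (Th-valid _ (Γ⊆Th Γθ) u))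

  validity⇔translation : ∀ φ → Valid 𝔽 A ℕ φ ⇔ Valid 𝔽 𝟚 τ* (Translate₃ φ)
  validity⇔translation φ = mk⇔ forward backward
    where
    premise : Fm 𝟚 τ*
    premise = ⋀ (map (λ m → □^ m (⋀ (constraints φ))) (upTo (suc (rank φ))))

    forward : Valid 𝔽 A ℕ φ → Valid 𝔽 𝟚 τ* (Translate₃ φ)
    forward valid F F∈𝔽 V* ev* isEv* _ w = to T-≡ (from (⊩-⇒ {φ = premise}) conclusion)
      where
      open ClassicalToManyValued em A isEv*
      conclusion : w ⊩ premise → w ⊩ q 1A φ
      conclusion w⊩premise =
        from (faithful-near φ id id (WithinSteps-map (to ⊩-⋀) (to (⊩-boxes {rank φ}) w⊩premise)) 1A)
             (valid F F∈𝔽 readOff evaluate evaluate-isEvaluation (λ _ ()) w)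

    backward : Valid 𝔽 𝟚 τ* (Translate₃ φ) → Valid 𝔽 A ℕ φ
    backward valid F F∈𝔽 V ev isEv _ w =
      to (faithful φ 1A)
         (to (⊩-⇒ {φ = premise} {ψ = q 1A φ}) w⊩translation (from (⊩-boxes {rank φ}) w⊩constraints))
      where
      open ManyValuedToClassical em A isEv
      w⊩translation : w ⊩ Translate₃ φ
      w⊩translation = from T-≡ (valid F F∈𝔽 indicator evaluate evaluate-isEvaluation (λ _ ()) w)
      w⊩constraints : WithinSteps F (rank φ) (_⊩ ⋀ (constraints φ)) w
      w⊩constraints _ _ = from (⊩-⋀ {L = constraints φ}) (⊩-constraintsOf {subs φ} {vars φ})

  consequence⇔translation : ∀ Γ φ → Consequence 𝔽 A ℕ Γ φ ⇔ Consequence 𝔽 𝟚 τ* (Theory₁ Γ) (q 1A φ)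
  consequence⇔translation Γ φ =
    mk⇔ (manyValued⇒classical (λ Γθ → inj₁ (_ , Γθ , refl)) (λ {θ} _ → constraints⊆Theory₁ {θ}))
        (classical⇒manyValued id)
    where
    constraints⊆Theory₁ : ∀ {θ χ} → χ ∈ constraints θ → Theory₁ Γ χ
    constraints⊆Theory₁ {θ} χ∈ with ∈-constraintsOf⁻ {subs θ} {vars θ} χ∈
    ... | inj₁ (p , _ , χ∈TFor) = inj₂ (inj₁ (p , χ∈TFor))
    ... | inj₂ (ψ , _ , χ∈E)    = inj₂ (inj₂ (ψ , χ∈E))

  finiteConsequence⇔translation : ∀ Γ φ →
    Consequence 𝔽 A ℕ (ListSet Γ) φ ⇔ Consequence 𝔽 𝟚 τ* (Theory₂ Γ φ) (q 1A φ)
  finiteConsequence⇔translation Γ φ =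
    mk⇔ (manyValued⇒classical (λ θ∈Γ → inj₁ (_ , θ∈Γ , refl)) constraints⊆Theory₂)
        (classical⇒manyValued Theory₂⊆Theory₁)
    where
    ∈-φ∷Γ : ∀ {θ} → θ ∈ Γ ⊎ θ ≡ φ → θ ∈ φ ∷ Γ
    ∈-φ∷Γ (inj₁ θ∈Γ) = there θ∈Γ
    ∈-φ∷Γ (inj₂ refl) = here refl
    constraints⊆Theory₂ : ∀ {θ} → θ ∈ Γ ⊎ θ ≡ φ → ∀ {χ} → χ ∈ constraints θ → Theory₂ Γ φ χ
    constraints⊆Theory₂ {θ} θ∈ χ∈ with ∈-constraintsOf⁻ {subs θ} {vars θ} χ∈
    ... | inj₁ (p , p∈ , χ∈TFor) = inj₂ (inj₁ (p , θ , ∈-φ∷Γ θ∈ , p∈ , χ∈TFor))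
    ... | inj₂ (ψ , ψ∈ , χ∈E)    = inj₂ (inj₂ (ψ , θ , ∈-φ∷Γ θ∈ , ψ∈ , χ∈E))
    Theory₂⊆Theory₁ : ∀ {χ} → Theory₂ Γ φ χ → Theory₁ (ListSet Γ) χ
    Theory₂⊆Theory₁ (inj₁ q1θ)                             = inj₁ q1θ
    Theory₂⊆Theory₁ (inj₂ (inj₁ (p , _ , _ , _ , χ∈TFor))) = inj₂ (inj₁ (p , χ∈TFor))
    Theory₂⊆Theory₁ (inj₂ (inj₂ (ψ , _ , _ , _ , χ∈E)))    = inj₂ (inj₂ (ψ , χ∈E))

mainTheorem9 : ExcludedMiddle 0ℓ →
    (A : LatticeAlgebra) (𝔽 : Pred Frame 0ℓ) →
    ((Γ : Pred (Fm A ℕ) 0ℓ) (φ : Fm A ℕ) →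
      Consequence 𝔽 A ℕ Γ φ
      ⇔ Consequence 𝔽 𝟚 (Translation.τ* A) (Translation.Theory₁ A Γ)
          (Translation.q A (LatticeAlgebra.1A A) φ))
    × ((Γ : List (Fm A ℕ)) (φ : Fm A ℕ) →
      Consequence 𝔽 A ℕ (Translation.ListSet A Γ) φ
      ⇔ Consequence 𝔽 𝟚 (Translation.τ* A) (Translation.Theory₂ A Γ φ)
          (Translation.q A (LatticeAlgebra.1A A) φ))
    × ((φ : Fm A ℕ) →
      Valid 𝔽 A ℕ φ ⇔ Valid 𝔽 𝟚 (Translation.τ* A) (Translation.Translate₃ A φ))
mainTheorem9 em A 𝔽 = consequence⇔translation , finiteConsequence⇔translation , validity⇔translation
  where open Transfer em A 𝔽
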